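{- Let $b$ be an even positive integer and let $w$ be an infinite smooth word over $\{1,b\}$ that is an infinite Lyndon word. Then $\Phi(w)$ starts with $1b$, i.e. $\Phi(w)[0]=1$ and $\Phi(w)[1]=b$.
   Context: Words are compared lexicographically with $1<b$. For a word $w$ over $\{1,b\}$ written as maximal blocks $\alpha_0^{i_0}\alpha_1^{i_1}\cdots$ ($\alpha_{k+1}\ne\alpha_k$, $i_k\ge1$), $\Delta(w)=i_0i_1\cdots$. An infinite word $w\in\{1,b\}^\omega$ is smooth if $\Delta^k(w)\in\{1,b\}^\omega$ for all $k\ge0$. $\Phi(w)=\Delta^0(w)[0]\,\Delta^1(w)[0]\,\Delta^2(w)[0]\cdots$. An infinite Lyndon word is an infinite word strictly smaller than each of its proper suffixes. -}

module Defs where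

open import Data.Nat using (ℕ; zero; suc; _+_; _<_; _≤_)
open import Data.Product using (Σ; _×_; ∃; _,_)
open import Data.Sum using (_⊎_)
open import Relation.Binary.PropositionalEquality using (_≡_; _≢_)

-- Infinite words are streams ℕ → ℕ; the letters are the naturals 1 and b,
-- so the lexicographic order with 1 < b is the order of ℕ on letters.
Word : Set
Word = ℕ → ℕ

InAlph : ℕ → ℕ → Set
InAlph b x = x ≡ 1 ⊎ x ≡ b

OverAlph : ℕ → Word → Set
OverAlph b w = ∀ n → InAlph b (w n)

_<lex_ : Word → Word → Set
u <lex v = ∃ λ j → (∀ m → m < j → u m ≡ v m) × u j < v j

suffix : ℕ → Word → Word
suffix i w n = w (n + i)

InfLyndon : Word → Set
InfLyndon w = ∀ i → 1 ≤ i → w <lex suffix i w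

blockStart : Word → ℕ → ℕ
blockStart v zero = 0
blockStart v (suc k) = blockStart v k + v k

-- IsDelta w v : v = Δ(w), i.e. w = α₀^{v 0} α₁^{v 1} ⋯ written in maximal
-- blocks (α_{k+1} ≠ α_k, v k ≥ 1), all blocks finite.
IsDelta : Word → Word → Set
IsDelta w v =
  (∀ k → 1 ≤ v k) ×
  (∀ k n → blockStart v k ≤ n → n < blockStart v (suc k) → w n ≡ w (blockStart v k)) ×
  (∀ k → w (blockStart v (suc k)) ≢ w (blockStart v k))

-- smoothness: the iterates Δ^k(w) (k ≥ 0) all exist and lie in {1,b}^ω.
-- A witness is the sequence k ↦ Δ^k(w) (uniquely determined by w).
Smooth : ℕ → Word → Set
Smooth b w =
  Σ (ℕ → Word) λ D →
    (∀ n → D 0 n ≡ w n) ×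
    (∀ k → OverAlph b (D k)) ×
    (∀ k → IsDelta (D k) (D (suc k)))

Φ : ∀ {b w} → Smooth b w → Word
Φ (D , _) k = D k 0

-- A Lyndon word is smaller than its suffix from position 1, and at the first
-- difference a letter 1 is followed by b; so w starts with 1. If moreover
-- Δ(w) started with 1, then w would start with 1b, and comparing w with its
-- suffixes shows that w has no factor 11. The blocks of w alternate between
-- letters 1 and b, so every even-indexed block is a single 1: Δ(w) is 1 at
-- all even positions. In such a word every maximal run of 1s has odd length,
-- which is not b since b is even, and every run of b's has length 1; hence
-- Δ²(w) is constantly 1, which leaves Δ³(w) undefined.
module Submission where

open import Defs
open import Data.Nat using (ℕ; zero; suc; _+_; _*_; _<_; _≤_; z≤n; s≤s)
open import Data.Nat.Properties
  using (<-irrefl; n<1⇒n≡0; n≤1+n; ≤-refl; ≤-trans; ≤-reflexive; +-comm; +-monoʳ-≤; *-distribʳ-+)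
open import Data.Nat.DivMod using (_/_; _%_; m%n<n; m≡m%n+[m/n]*n)
open import Data.Nat.Divisibility using (_∣_; divides)
open import Data.Product using (_×_; _,_; ∃; proj₂)
open import Data.Sum using (_⊎_; inj₁; inj₂)
open import Data.Empty using (⊥-elim)
open import Function using (_∘_)
open import Relation.Binary.PropositionalEquality
  using (_≡_; _≢_; _≗_; refl; sym; trans; cong; cong₂; subst; subst₂)

even-or-odd : ∀ n → ∃ λ m → n ≡ m * 2 ⊎ n ≡ suc (m * 2)
even-or-odd n with n % 2 | m%n<n n 2 | m≡m%n+[m/n]*n n 2
... | 0           | _            | e = n / 2 , inj₁ e
... | 1           | _            | e = n / 2 , inj₂ e
... | suc (suc _) | s≤s (s≤s ()) | _

module _ {b : ℕ} where

  InAlph-≢1 : ∀ {x} → InAlph b x → x ≢ 1 → x ≡ b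
  InAlph-≢1 (inj₁ x≡1) x≢1 = ⊥-elim (x≢1 x≡1)
  InAlph-≢1 (inj₂ x≡b) _   = x≡b

  InAlph-≢b : ∀ {x} → InAlph b x → x ≢ b → x ≡ 1
  InAlph-≢b (inj₁ x≡1) _   = x≡1
  InAlph-≢b (inj₂ x≡b) x≢b = ⊥-elim (x≢b x≡b)

  InAlph-<⇒≡1 : 0 < b → ∀ {x y} → InAlph b x → InAlph b y → x < y → x ≡ 1
  InAlph-<⇒≡1 _   (inj₁ x≡1) _          _   = x≡1
  InAlph-<⇒≡1 0<b (inj₂ refl) (inj₁ refl) x<y with n<1⇒n≡0 x<y
  ... | refl = ⊥-elim (<-irrefl refl 0<b)
  InAlph-<⇒≡1 _   (inj₂ refl) (inj₂ refl) x<y = ⊥-elim (<-irrefl refl x<y)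

InfLyndon-resp-≗ : ∀ {u v} → u ≗ v → InfLyndon u → InfLyndon v
InfLyndon-resp-≗ u≗v lyndon i 1≤i with lyndon i 1≤i
... | j , same , less =
  j , (λ m m<j → trans (sym (u≗v m)) (trans (same m m<j) (u≗v (m + i))))
    , subst₂ _<_ (u≗v j) (u≗v (j + i)) less

module _ {b : ℕ} {w : Word} (0<b : 0 < b) (over : OverAlph b w) (lyndon : InfLyndon w) where

  Lyndon-head≡1 : w 0 ≡ 1
  Lyndon-head≡1 with lyndon 1 (s≤s z≤n)
  ... | j , same , less =
    trans (constant j ≤-refl) (InAlph-<⇒≡1 0<b (over j) (over (j + 1)) less)
    where
    constant : ∀ m → m ≤ j → w 0 ≡ w m
    constant zero    _   = refl
    constant (suc m) m<j =
      trans (constant m (≤-trans (n≤1+n m) m<j)) (trans (same m m<j) (cong w (+-comm m 1)))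

  Lyndon-isolated-1 : w 1 ≢ 1 → ∀ i → w i ≡ 1 → w (suc i) ≢ 1
  Lyndon-isolated-1 w1≢1 zero    _     = w1≢1
  Lyndon-isolated-1 w1≢1 (suc i) wi≡1 wi+1≡1 with lyndon (suc i) (s≤s z≤n)
  ... | zero , _ , less =
    <-irrefl (trans Lyndon-head≡1 (sym wi≡1)) less
  ... | suc zero , _ , less =
    w1≢1 (InAlph-<⇒≡1 0<b (over 1) (over (suc (suc i))) less)
  ... | suc (suc _) , same , _ =
    w1≢1 (trans (same 1 (s≤s (s≤s z≤n))) wi+1≡1)

blockStart-suc : ∀ {v : Word} {k} → blockStart v k ≡ k → v k ≡ 1 → blockStart v (suc k) ≡ suc k
blockStart-suc {k = k} start≡k vk≡1 = trans (cong₂ _+_ start≡k vk≡1) (+-comm k 1)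

block-length≡1 : ∀ {b u v} → 2 ≤ b → OverAlph b v → IsDelta u v →
  ∀ k → u (suc (blockStart v k)) ≢ u (blockStart v k) → v k ≡ 1
block-length≡1 {b} {u} {v} 2≤b over (_ , constant , _) k differs with over k
... | inj₁ vk≡1 = vk≡1
... | inj₂ vk≡b = ⊥-elim (differs (constant k (suc s) (n≤1+n s) s+1<end))
  where
  s : ℕ
  s = blockStart v k

  s+1<end : suc s < s + v k
  s+1<end = ≤-trans (≤-reflexive (+-comm 2 s)) (+-monoʳ-≤ s (subst (2 ≤_) (sym vk≡b) 2≤b))

blockLetter-even : ∀ {b u v} → OverAlph b u → IsDelta u v → u 0 ≡ 1 →
  ∀ m → u (blockStart v (m * 2)) ≡ 1
blockLetter-even over _ u0≡1 zero = u0≡1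
blockLetter-even {b} {u} {v} over Δ@(_ , _ , boundary) u0≡1 (suc m) =
  InAlph-≢b (over _) λ e → boundary (suc (m * 2)) (trans e (sym odd≡b))
  where
  odd≡b : u (blockStart v (suc (m * 2))) ≡ b
  odd≡b = InAlph-≢1 (over _) λ e →
    boundary (m * 2) (trans e (sym (blockLetter-even over Δ u0≡1 m)))

-- The blocks of v start at 0, 1, 2, ...: a block of length b at an even start
-- would end at an even position, and one at an odd start would swallow the
-- following even position.
even-ones⇒Δ≡1 : ∀ {b c u v} → b ≡ c * 2 → 2 ≤ b → OverAlph b v → IsDelta u v →
  (∀ m → u (m * 2) ≡ 1) → ∀ n → v n ≡ 1
even-ones⇒Δ≡1 {b} {c} {u} {v} b≡c*2 2≤b over Δ@(_ , _ , boundary) even≡1 = all-ones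
  where
  start-letter : ∀ m → blockStart v (m * 2) ≡ m * 2 → u (blockStart v (m * 2)) ≡ 1
  start-letter m start≡ = trans (cong u start≡) (even≡1 m)

  v-even : ∀ m → blockStart v (m * 2) ≡ m * 2 → v (m * 2) ≡ 1
  v-even m start≡ with over (m * 2)
  ... | inj₁ v≡1 = v≡1
  ... | inj₂ v≡b = ⊥-elim (boundary (m * 2) (trans next≡1 (sym (start-letter m start≡))))
    where
    next≡1 : u (blockStart v (m * 2) + v (m * 2)) ≡ 1
    next≡1 = trans (cong u (trans (cong₂ _+_ start≡ (trans v≡b b≡c*2)) (sym (*-distribʳ-+ 2 m c))))
                   (even≡1 (m + c))

  v-odd : ∀ m → blockStart v (m * 2) ≡ m * 2 → v (suc (m * 2)) ≡ 1
  v-odd m start≡ = block-length≡1 2≤b over Δ (suc (m * 2)) λ e →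
    boundary (m * 2) (trans (sym e) (trans (cong (u ∘ suc) odd-start)
                                           (trans (even≡1 (suc m)) (sym (start-letter m start≡)))))
    where
    odd-start : blockStart v (suc (m * 2)) ≡ suc (m * 2)
    odd-start = blockStart-suc start≡ (v-even m start≡)

  start-even : ∀ m → blockStart v (m * 2) ≡ m * 2
  start-even zero    = refl
  start-even (suc m) =
    blockStart-suc (blockStart-suc (start-even m) (v-even m (start-even m))) (v-odd m (start-even m))

  all-ones : ∀ n → v n ≡ 1
  all-ones n with even-or-odd n
  ... | m , inj₁ refl = v-even m (start-even m)
  ... | m , inj₂ refl = v-odd m (start-even m)

lemma31 : (b : ℕ) → 0 < b → 2 ∣ b → (w : Word) → (s : Smooth b w) →
    InfLyndon w → Φ s 0 ≡ 1 × Φ s 1 ≡ b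
lemma31 _ ()  (divides zero refl)
lemma31 b 0<b (divides (suc c) refl) w (D , D0≗w , over , Δ) lyndon =
  head≡1 , InAlph-≢1 (over 1 0) Δ-head≢1
  where
  2≤b : 2 ≤ b
  2≤b = s≤s (s≤s z≤n)

  lyndon₀ : InfLyndon (D 0)
  lyndon₀ = InfLyndon-resp-≗ (sym ∘ D0≗w) lyndon

  head≡1 : D 0 0 ≡ 1
  head≡1 = Lyndon-head≡1 0<b (over 0) lyndon₀

  Δ-head≢1 : D 1 0 ≢ 1
  Δ-head≢1 Δ-head≡1 = proj₂ (proj₂ (Δ 2)) 0 (trans (Δ²≡1 _) (sym (Δ²≡1 0)))
    where
    second≢1 : D 0 1 ≢ 1
    second≢1 e = proj₂ (proj₂ (Δ 0)) 0
      (trans (subst (λ i → D 0 i ≡ 1) (sym Δ-head≡1) e) (sym head≡1))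

    Δ-even≡1 : ∀ m → D 1 (m * 2) ≡ 1
    Δ-even≡1 m = block-length≡1 2≤b (over 1) (Δ 0) (m * 2) λ e →
      Lyndon-isolated-1 0<b (over 0) lyndon₀ second≢1 _ start≡1 (trans e start≡1)
      where
      start≡1 : D 0 (blockStart (D 1) (m * 2)) ≡ 1
      start≡1 = blockLetter-even (over 0) (Δ 0) head≡1 m

    Δ²≡1 : ∀ n → D 2 n ≡ 1
    Δ²≡1 = even-ones⇒Δ≡1 {c = suc c} refl 2≤b (over 2) (Δ 1) Δ-even≡1
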